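{- Let $G$ be a finite group of order $n=(z+r)^2+z+1$ and let $S=S_1\cup S_2\subseteq G\setminus\{1\}$ with $S_1=S_1^{ -1}$, $S_2\cap S_2^{ -1}=\emptyset$, $|S_1|=r$, $|S_2|=z$, such that the Cayley graph $\mathrm{Cay}(G,S)$ is a mixed Moore graph of diameter 2, undirected degree $r$ and directed degree $z$. If $2(z+r)-\sqrt{4r-3}>9$, then $G$ does not contain an abelian subgroup of index 2.
   Context: For a finite group $G$ and $S\subseteq G\setminus\{1\}$, the Cayley graph $\mathrm{Cay}(G,S)$ has vertex set $G$ and an arc from $g$ to $gs$ for every $g\in G$, $s\in S$; when $s,s^{ -1}\in S$ the pair of arcs between $g$ and $gs$ is regarded as one undirected edge. With $S=S_1\cup S_2$, $S_1=S_1^{ -1}$, $S_2\cap S_2^{ -1}=\emptyset$, this is a mixed graph of undirected degree $|S_1|$ and directed out-degree $|S_2|$. Undirected edges may be traversed in either direction and arcs only in their direction; distance and diameter are defined accordingly. A mixed Moore graph of diameter 2, undirected degree $r$ and directed degree $z$ is a mixed graph of diameter 2 with every vertex having at most $r$ undirected edges and at most $z$ out-arcs, and with exactly $(z+r)^2+z+1$ vertices. -}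

module Defs where

open import Level using (Level; _⊔_)
open import Data.Nat using (ℕ; _+_; _*_; _∸_; _^_; _≤_; _<_)
open import Data.Fin using (Fin)
open import Data.Product using (Σ; ∃; _×_; _,_)
open import Data.Sum using (_⊎_)
open import Relation.Nullary using (¬_)
open import Relation.Binary.PropositionalEquality using (_≡_)
import Relation.Binary.PropositionalEquality as ≡
open import Algebra.Bundles using (Group)
open import Function.Bundles using (Bijection)

FiniteOfOrder : ∀ {c ℓ} → Group c ℓ → ℕ → Set (c ⊔ ℓ)
FiniteOfOrder G n = Bijection (≡.setoid (Fin n)) (Group.setoid G)

module _ {c ℓ} (G : Group c ℓ) where
  open Group G

  -- A finite subset of G of cardinality k, given as an injective
  -- enumeration Fin k → G (injective w.r.t. ≈).
  DistinctEnum : (k : ℕ) → (Fin k → Carrier) → Set ℓ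
  DistinctEnum k s = ∀ i j → s i ≈ s j → i ≡ j

  _∈ₑ_ : ∀ {k} → Carrier → (Fin k → Carrier) → Set ℓ
  x ∈ₑ s = ∃ λ i → x ≈ s i

  -- Connection set S = S₁ ∪ S₂ with |S₁| = r, |S₂| = z, S ⊆ G ∖ {1},
  -- S₁ = S₁⁻¹, S₂ ∩ S₂⁻¹ = ∅, and S₁ ∩ S₂ = ∅ (the union is the
  -- decomposition of S into undirected and directed generators).
  record MixedConnectionSet (r z : ℕ) (s₁ : Fin r → Carrier) (s₂ : Fin z → Carrier) : Set (c ⊔ ℓ) where
    field
      s₁-distinct : DistinctEnum r s₁
      s₂-distinct : DistinctEnum z s₂
      s₁-nonid    : ∀ i → ¬ (s₁ i ≈ ε)
      s₂-nonid    : ∀ i → ¬ (s₂ i ≈ ε)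
      s₁-symm     : ∀ i → (s₁ i ⁻¹) ∈ₑ s₁
      s₂-asymm    : ∀ i j → ¬ (s₂ i ⁻¹ ≈ s₂ j)
      disjoint    : ∀ i j → ¬ (s₁ i ≈ s₂ j)

  InS : ∀ {r z} → (Fin r → Carrier) → (Fin z → Carrier) → Carrier → Set ℓ
  InS s₁ s₂ x = x ∈ₑ s₁ ⊎ x ∈ₑ s₂

  -- One step in Cay(G,S): from g to g·s, s ∈ S.  (An undirected edge
  -- {g, gs}, s ∈ S₁, traversed backwards is the step gs → gs·s⁻¹ with
  -- s⁻¹ ∈ S₁, so steps are exactly right multiplications by S.)
  Step : ∀ {r z} → (Fin r → Carrier) → (Fin z → Carrier) → Carrier → Carrier → Set (c ⊔ ℓ)
  Step s₁ s₂ g h = ∃ λ s → InS s₁ s₂ s × (h ≈ g ∙ s)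

  Dist≤1 : ∀ {r z} → (Fin r → Carrier) → (Fin z → Carrier) → Carrier → Carrier → Set (c ⊔ ℓ)
  Dist≤1 s₁ s₂ g h = (g ≈ h) ⊎ Step s₁ s₂ g h

  Dist≤2 : ∀ {r z} → (Fin r → Carrier) → (Fin z → Carrier) → Carrier → Carrier → Set (c ⊔ ℓ)
  Dist≤2 s₁ s₂ g h = Dist≤1 s₁ s₂ g h ⊎ (∃ λ m → Step s₁ s₂ g m × Step s₁ s₂ m h)

  Diameter2 : ∀ {r z} → (Fin r → Carrier) → (Fin z → Carrier) → Set (c ⊔ ℓ)
  Diameter2 s₁ s₂ = (∀ g h → Dist≤2 s₁ s₂ g h) × (∃ λ g → ∃ λ h → ¬ Dist≤1 s₁ s₂ g h)

  -- Cay(G,S) is a mixed Moore graph of diameter 2, undirected degree r,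
  -- directed degree z: diameter 2 and |G| = (z+r)^2 + z + 1.
  -- (Each vertex g has exactly r undirected edges {g, g s}, s ∈ S₁, and
  -- z out-arcs (g, g s), s ∈ S₂, by the MixedConnectionSet conditions.)
  MixedMooreCayley : (n r z : ℕ) → (Fin r → Carrier) → (Fin z → Carrier) → Set (c ⊔ ℓ)
  MixedMooreCayley n r z s₁ s₂ = Diameter2 s₁ s₂ × (n ≡ (z + r) ^ 2 + z + 1)

  record AbelianSubgroupOfIndex2 (n : ℕ) : Set (c ⊔ ℓ) where
    field
      m        : ℕ
      h        : Fin m → Carrier
      distinct : DistinctEnum m h
      has-ε    : ε ∈ₑ h
      ∙-closed : ∀ i j → (h i ∙ h j) ∈ₑ h
      ⁻¹-closed : ∀ i → (h i ⁻¹) ∈ₑ h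
      abelian  : ∀ i j → h i ∙ h j ≈ h j ∙ h i
      index2   : 2 * m ≡ n

-- The real inequality 2(z+r) − √(4r−3) > 9 (√ of a nonnegative real, so
-- 4r ≥ 3 is needed for it to make sense), rendered over ℕ:
-- a − √b > 9  ⇔  a > 9 ∧ (a − 9)² > b   for a, b ≥ 0.
MooreBound : (r z : ℕ) → Set
MooreBound r z = (3 ≤ 4 * r) × (9 < 2 * (z + r)) × (4 * r ∸ 3 < (2 * (z + r) ∸ 9) ^ 2)

-- Let H be the abelian subgroup of index 2, a = |S ∩ H| and b = |S ∖ H|, so a + b = z + r.
-- In a mixed Moore graph of diameter 2 a non-identity element is the value of at most one word
-- s or st (s, t ∈ S), so two distinct commuting generators are mutually inverse; as H is abelian,
-- a ≤ 2.  A product of two elements outside H lies in H, so each of the n/2 elements outside H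
-- is a generator outside H or a product of a generator in H and one outside: n/2 ≤ b + 2ab.
-- With a ≤ 2 and n = (z + r)² + z + 1 this leaves finitely many cases, all violating
-- 2(z + r) − √(4r − 3) > 9.

module Submission where

open import Defs
open import Data.Nat using (ℕ; zero; suc; _+_; _*_; _∸_; _^_; z<s; _≤_; _<_; _≤?_; _<?_; z≤n; s≤s)
open import Data.Fin using (Fin; zero; suc; _↑ˡ_; _↑ʳ_; splitAt; join)
open import Relation.Nullary using (¬_; Dec; yes; no; ¬?)
open import Algebra.Bundles using (Group)
open import Function using (_∘_)
open import Function.Bundles using (Bijection)
open import Data.Empty using (⊥-elim)
open import Data.Nat.Properties
open import Data.Nat.Solver using (module +-*-Solver)
open import Data.Fin.Properties
  using (any?; ↑ˡ-injective; splitAt-↑ˡ; splitAt-↑ʳ; join-splitAt) renaming (_≟_ to _≟ᶠ_)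
open import Data.Product using (∃; _×_; _,_; proj₁; proj₂)
import Data.Product.Properties as Product
open import Data.Sum using (_⊎_; inj₁; inj₂; [_,_]′)
import Data.Sum.Properties as Sum
open import Data.List using (List; []; _∷_; length; filter; map; _++_; cartesianProduct; allFin)
open import Data.List.Properties using (filter-notAll; length-++; length-map; length-tabulate)
open import Data.List.Membership.Propositional using (_∈_)
open import Data.List.Membership.Propositional.Properties
  using (∈-filter⁺; ∈-filter⁻; ∈-map⁺; ∈-map⁻; ∈-++⁺ˡ; ∈-++⁺ʳ; ∈-allFin; ∈-cartesianProduct⁺)
open import Data.List.Relation.Unary.Any using (Any; here; there)
import Data.List.Relation.Unary.Any as Any
open import Data.List.Relation.Unary.All using (All; _∷_)
import Data.List.Relation.Unary.All as All
open import Data.List.Relation.Unary.All.Properties using (all-filter)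
open import Data.List.Relation.Unary.Unique.Propositional using (Unique; _∷_)
import Data.List.Relation.Unary.Unique.Propositional.Properties as Unique
open import Data.List.Relation.Binary.Subset.Propositional using (_⊆_)
open import Relation.Nullary.Decidable using (_×-dec_; _→-dec_; from-yes)
open import Relation.Unary using (Pred; Decidable; ∁)
open import Relation.Unary.Properties using (∁?)
open import Relation.Binary using (Setoid; DecidableEquality; _Respects_)
open import Relation.Binary.PropositionalEquality as ≡ using (_≡_; _≢_)

module _ {a p} {A : Set a} {P : Pred A p} (P? : Decidable P) where

  length-filter+length-filter-∁ : ∀ xs → length (filter P? xs) + length (filter (∁? P?) xs) ≡ length xs
  length-filter+length-filter-∁ [] = ≡.refl
  length-filter+length-filter-∁ (x ∷ xs) with P? x
  ... | yes _ = ≡.cong suc (length-filter+length-filter-∁ xs)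
  ... | no _  = ≡.trans (+-suc _ _) (≡.cong suc (length-filter+length-filter-∁ xs))

length-cartesianProduct : ∀ {a b} {A : Set a} {B : Set b} (xs : List A) (ys : List B) →
                          length (cartesianProduct xs ys) ≡ length xs * length ys
length-cartesianProduct []       ys = ≡.refl
length-cartesianProduct (x ∷ xs) ys = begin
  length (map (x ,_) ys ++ cartesianProduct xs ys)  ≡⟨ length-++ (map (x ,_) ys) ⟩
  length (map (x ,_) ys) + length (cartesianProduct xs ys)
    ≡⟨ ≡.cong₂ _+_ (length-map (x ,_) ys) (length-cartesianProduct xs ys) ⟩
  length ys + length xs * length ys  ∎
  where open ≡.≡-Reasoning

length-allFin : ∀ n → length (allFin n) ≡ n
length-allFin n = length-tabulate {n = n} (λ i → i)

module _ {a} {A : Set a} (_≟_ : DecidableEquality A) where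

  Unique∧⊆⇒length≤ : ∀ {xs ys : List A} → Unique xs → xs ⊆ ys → length xs ≤ length ys
  Unique∧⊆⇒length≤ {[]}     _          _  = z≤n
  Unique∧⊆⇒length≤ {x ∷ xs} {ys} (x∉xs ∷ xs!) x∷xs⊆ys =
    ≤-trans (s≤s (Unique∧⊆⇒length≤ xs! xs⊆ys-x)) (filter-notAll ≢x? ys ¬¬x∈ys)
    where
      ≢x? : Decidable (_≢ x)
      ≢x? y = ¬? (y ≟ x)
      xs⊆ys-x : xs ⊆ filter ≢x? ys
      xs⊆ys-x y∈xs = ∈-filter⁺ ≢x? (x∷xs⊆ys (there y∈xs))
                               λ { ≡.refl → All.lookup x∉xs y∈xs ≡.refl }
      ¬¬x∈ys : Any (λ y → ¬ ¬ (y ≡ x)) ys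
      ¬¬x∈ys = Any.map (λ x≡y y≢x → y≢x (≡.sym x≡y)) (x∷xs⊆ys (here ≡.refl))

  Unique∧⊆∧∁⇒length≤ : ∀ {p} {P : Pred A p} (P? : Decidable P) {xs ys} →
                       Unique ys → ys ⊆ xs → All (∁ P) ys →
                       length (filter P? xs) + length ys ≤ length xs
  Unique∧⊆∧∁⇒length≤ P? {xs} {ys} ys! ys⊆xs ys∉P = begin
    length (filter P? xs) + length ys                  ≤⟨ +-monoʳ-≤ _ (Unique∧⊆⇒length≤ ys! ys⊆xs∖P) ⟩
    length (filter P? xs) + length (filter (∁? P?) xs) ≡⟨ length-filter+length-filter-∁ P? xs ⟩
    length xs                                          ∎
    where
      open ≤-Reasoning
      ys⊆xs∖P : ys ⊆ filter (∁? P?) xs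
      ys⊆xs∖P y∈ys = ∈-filter⁺ (∁? P?) (ys⊆xs y∈ys) (All.lookup ys∉P y∈ys)

module FiniteSetoid {c ℓ} {S : Setoid c ℓ} {n : ℕ} (enumeration : Bijection (≡.setoid (Fin n)) S) where

  open Setoid S
  open Bijection enumeration using (to; strictlySurjective) renaming (cong to to-cong; injective to to-injective)

  index : Carrier → Fin n
  index x = proj₁ (strictlySurjective x)

  to-index : ∀ x → to (index x) ≈ x
  to-index x = proj₂ (strictlySurjective x)

  index-cong : ∀ {x y} → x ≈ y → index x ≡ index y
  index-cong {x} {y} x≈y = to-injective (trans (to-index x) (trans x≈y (sym (to-index y))))

  index-to : ∀ i → index (to i) ≡ i
  index-to i = to-injective (to-index (to i))

  index-injective : ∀ {x y} → index x ≡ index y → x ≈ y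
  index-injective {x} {y} i≡j = trans (sym (to-index x)) (trans (to-cong i≡j) (to-index y))

  _≈?_ : ∀ x y → Dec (x ≈ y)
  x ≈? y with index x ≟ᶠ index y
  ... | yes i≡j = yes (index-injective i≡j)
  ... | no  i≢j = no (i≢j ∘ index-cong)

  count : ∀ {p} {P : Pred Carrier p} → Decidable P → ℕ
  count P? = length (filter (P? ∘ to) (allFin n))

  module _ {p} {P : Pred Carrier p} (P? : Decidable P) where

    count+count-∁ : count P? + count (∁? P?) ≡ n
    count+count-∁ = ≡.trans (length-filter+length-filter-∁ (P? ∘ to) (allFin n)) (length-allFin n)

    cover⇒count≤length : ∀ {a} {A : Set a} (f : A → Carrier) (ws : List A) →
                         (∀ {x} → P x → ∃ λ w → w ∈ ws × f w ≈ x) → count P? ≤ length ws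
    cover⇒count≤length f ws covers = begin
      count P?                     ≤⟨ Unique∧⊆⇒length≤ _≟ᶠ_ P! P⊆f[ws] ⟩
      length (map (index ∘ f) ws)  ≡⟨ length-map (index ∘ f) ws ⟩
      length ws                    ∎
      where
        open ≤-Reasoning
        P! : Unique (filter (P? ∘ to) (allFin n))
        P! = Unique.filter⁺ (P? ∘ to) (Unique.allFin⁺ n)
        P⊆f[ws] : filter (P? ∘ to) (allFin n) ⊆ map (index ∘ f) ws
        P⊆f[ws] {i} i∈P with covers (proj₂ (∈-filter⁻ (P? ∘ to) {xs = allFin n} i∈P))
        ... | w , w∈ws , fw≈i = ≡.subst (_∈ map (index ∘ f) ws) (≡.trans (index-cong fw≈i) (index-to i))
                                         (∈-map⁺ (index ∘ f) w∈ws)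

    injection⇒≤count : P Respects _≈_ → ∀ {k} (f : Fin k → Carrier) →
                       (∀ i j → f i ≈ f j → i ≡ j) → (∀ i → P (f i)) → k ≤ count P?
    injection⇒≤count resp {k} f f-injective f∈P = begin
      k                                    ≡⟨ length-allFin k ⟨
      length (allFin k)                    ≡⟨ length-map (index ∘ f) (allFin k) ⟨
      length (map (index ∘ f) (allFin k))  ≤⟨ Unique∧⊆⇒length≤ _≟ᶠ_ f[Fin]! f[Fin]⊆P ⟩
      count P?                             ∎
      where
        open ≤-Reasoning
        f[Fin]! : Unique (map (index ∘ f) (allFin k))
        f[Fin]! = Unique.map⁺ (f-injective _ _ ∘ index-injective) (Unique.allFin⁺ k)
        f[Fin]⊆P : map (index ∘ f) (allFin k) ⊆ filter (P? ∘ to) (allFin n)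
        f[Fin]⊆P j∈ with ∈-map⁻ (index ∘ f) j∈
        ... | i , _ , ≡.refl = ∈-filter⁺ (P? ∘ to) (∈-allFin _) (resp (sym (to-index (f i))) (f∈P i))

module IndexTwoSubgroup {c ℓ} (G : Group c ℓ) {n : ℕ} (enumeration : FiniteOfOrder G n)
                        (H : AbelianSubgroupOfIndex2 G n) where

  open Group G
  open AbelianSubgroupOfIndex2 H
  open FiniteSetoid enumeration
  open import Algebra.Properties.Group G using (∙-cancelˡ; \\-leftDividesˡ; //-rightDividesʳ; ⁻¹-involutive)

  _∈H : Pred Carrier ℓ
  x ∈H = _∈ₑ_ G x h

  _∈H? : Decidable _∈H
  x ∈H? = any? (λ i → x ≈? h i)

  ∈H-resp : _∈H Respects _≈_
  ∈H-resp x≈y (i , x≈hᵢ) = i , trans (sym x≈y) x≈hᵢ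

  ∉H-resp : ∁ _∈H Respects _≈_
  ∉H-resp x≈y x∉H = x∉H ∘ ∈H-resp (sym x≈y)

  ∙-∈H : ∀ {x y} → x ∈H → y ∈H → (x ∙ y) ∈H
  ∙-∈H (i , x≈hᵢ) (j , y≈hⱼ) with ∙-closed i j
  ... | k , hᵢhⱼ≈hₖ = k , trans (∙-cong x≈hᵢ y≈hⱼ) hᵢhⱼ≈hₖ

  ⁻¹-∈H : ∀ {x} → x ∈H → (x ⁻¹) ∈H
  ⁻¹-∈H (i , x≈hᵢ) with ⁻¹-closed i
  ... | k , hᵢ⁻¹≈hₖ = k , trans (⁻¹-cong x≈hᵢ) hᵢ⁻¹≈hₖ

  ∈H-comm : ∀ {x y} → x ∈H → y ∈H → x ∙ y ≈ y ∙ x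
  ∈H-comm (i , x≈hᵢ) (j , y≈hⱼ) =
    trans (∙-cong x≈hᵢ y≈hⱼ) (trans (abelian i j) (sym (∙-cong y≈hⱼ x≈hᵢ)))

  count-∈H : count _∈H? ≡ m
  count-∈H = ≤-antisym
    (≤-trans (cover⇒count≤length _∈H? h (allFin m) h-covers) (≤-reflexive (length-allFin m)))
    (injection⇒≤count _∈H? ∈H-resp h distinct (λ i → i , refl))
    where
      h-covers : ∀ {x} → x ∈H → ∃ λ i → i ∈ allFin m × h i ≈ x
      h-covers (i , x≈hᵢ) = i , ∈-allFin i , sym x≈hᵢ

  count-∉H : count (∁? _∈H?) ≡ m
  count-∉H = +-cancelˡ-≡ m _ _ (begin
    m + count (∁? _∈H?)              ≡⟨ ≡.cong (_+ count (∁? _∈H?)) count-∈H ⟨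
    count _∈H? + count (∁? _∈H?)     ≡⟨ count+count-∁ _∈H? ⟩
    n                                ≡⟨ index2 ⟨
    m + (m + 0)                      ≡⟨ ≡.cong (m +_) (+-identityʳ m) ⟩
    m + m                            ∎)
    where open ≡.≡-Reasoning

  -- Otherwise y and the m elements of x⁻¹H would be m + 1 distinct elements outside H.
  ∉H∙∉H⇒∈H : ∀ {x y} → ¬ x ∈H → ¬ y ∈H → (x ∙ y) ∈H
  ∉H∙∉H⇒∈H {x} {y} x∉H y∉H with (x ∙ y) ∈H?
  ... | yes xy∈H = xy∈H
  ... | no  xy∉H =
    ⊥-elim (<-irrefl (≡.sym count-∉H) (injection⇒≤count (∁? _∈H?) ∉H-resp f f-injective f∉H))
    where
      f : Fin (suc m) → Carrier
      f zero    = y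
      f (suc i) = x ⁻¹ ∙ h i

      y≉x⁻¹hᵢ : ∀ i → ¬ y ≈ x ⁻¹ ∙ h i
      y≉x⁻¹hᵢ i y≈x⁻¹hᵢ = xy∉H (i , trans (∙-congˡ y≈x⁻¹hᵢ) (\\-leftDividesˡ x (h i)))

      f-injective : ∀ i j → f i ≈ f j → i ≡ j
      f-injective zero    zero    _ = ≡.refl
      f-injective zero    (suc j) e = ⊥-elim (y≉x⁻¹hᵢ j e)
      f-injective (suc i) zero    e = ⊥-elim (y≉x⁻¹hᵢ i (sym e))
      f-injective (suc i) (suc j) e = ≡.cong suc (distinct i j (∙-cancelˡ (x ⁻¹) (h i) (h j) e))

      f∉H : ∀ i → ¬ f i ∈H
      f∉H zero    = y∉H
      f∉H (suc i) x⁻¹hᵢ∈H = x∉H (∈H-resp (⁻¹-involutive x) (⁻¹-∈H x⁻¹∈H))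
        where
          x⁻¹∈H : (x ⁻¹) ∈H
          x⁻¹∈H = ∈H-resp (//-rightDividesʳ (h i) (x ⁻¹)) (∙-∈H x⁻¹hᵢ∈H (⁻¹-∈H (i , refl)))

module MixedMooreCayleyGraph {c ℓ} (G : Group c ℓ) {n r z : ℕ} (enumeration : FiniteOfOrder G n)
  {s₁ : Fin r → Group.Carrier G} {s₂ : Fin z → Group.Carrier G}
  (S : MixedConnectionSet G r z s₁ s₂) (moore : MixedMooreCayley G n r z s₁ s₂) where

  open Group G
  open MixedConnectionSet S
  open FiniteSetoid enumeration
  open import Algebra.Properties.Group G using (∙-cancelˡ)

  Generator : Set
  Generator = Fin (r + z)

  gen : Generator → Carrier
  gen = [ s₁ , s₂ ]′ ∘ splitAt r

  gen-↑ˡ : ∀ i → gen (i ↑ˡ z) ≡ s₁ i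
  gen-↑ˡ i = ≡.cong [ s₁ , s₂ ]′ (splitAt-↑ˡ r i z)

  gen-↑ʳ : ∀ j → gen (r ↑ʳ j) ≡ s₂ j
  gen-↑ʳ j = ≡.cong [ s₁ , s₂ ]′ (splitAt-↑ʳ r z j)

  ∈S⇒gen : ∀ {s} → InS G s₁ s₂ s → ∃ λ i → s ≈ gen i
  ∈S⇒gen (inj₁ (i , s≈s₁ᵢ)) = i ↑ˡ z , trans s≈s₁ᵢ (reflexive (≡.sym (gen-↑ˡ i)))
  ∈S⇒gen (inj₂ (j , s≈s₂ⱼ)) = r ↑ʳ j , trans s≈s₂ⱼ (reflexive (≡.sym (gen-↑ʳ j)))

  gen-injective : ∀ {i j} → gen i ≈ gen j → i ≡ j
  gen-injective {i} {j} gᵢ≈gⱼ = begin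
    i                         ≡⟨ join-splitAt r z i ⟨
    join r z (splitAt r i)    ≡⟨ ≡.cong (join r z) (split-injective (splitAt r i) (splitAt r j) gᵢ≈gⱼ) ⟩
    join r z (splitAt r j)    ≡⟨ join-splitAt r z j ⟩
    j                         ∎
    where
      open ≡.≡-Reasoning
      split-injective : ∀ u v → [ s₁ , s₂ ]′ u ≈ [ s₁ , s₂ ]′ v → u ≡ v
      split-injective (inj₁ i) (inj₁ j) e = ≡.cong inj₁ (s₁-distinct i j e)
      split-injective (inj₁ i) (inj₂ j) e = ⊥-elim (disjoint i j e)
      split-injective (inj₂ i) (inj₁ j) e = ⊥-elim (disjoint j i (sym e))
      split-injective (inj₂ i) (inj₂ j) e = ≡.cong inj₂ (s₂-distinct i j e)

  Word : Set
  Word = Generator ⊎ (Generator × Generator)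

  _≟ʷ_ : DecidableEquality Word
  _≟ʷ_ = Sum.≡-dec _≟ᶠ_ (Product.≡-dec _≟ᶠ_ _≟ᶠ_)

  eval : Word → Carrier
  eval (inj₁ i)       = gen i
  eval (inj₂ (i , j)) = gen i ∙ gen j

  words : List Generator → List (Generator × Generator) → List Word
  words gs ps = map inj₁ gs ++ map inj₂ ps

  length-words : ∀ gs ps → length (words gs ps) ≡ length gs + length ps
  length-words gs ps =
    ≡.trans (length-++ (map inj₁ gs)) (≡.cong₂ _+_ (length-map inj₁ gs) (length-map inj₂ ps))

  inj₁∈words : ∀ {i gs} ps → i ∈ gs → inj₁ i ∈ words gs ps
  inj₁∈words ps i∈gs = ∈-++⁺ˡ (∈-map⁺ inj₁ i∈gs)

  inj₂∈words : ∀ {p ps} gs → p ∈ ps → inj₂ p ∈ words gs ps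
  inj₂∈words gs p∈ps = ∈-++⁺ʳ (map inj₁ gs) (∈-map⁺ inj₂ p∈ps)

  allWords : List Word
  allWords = words (allFin (r + z)) (cartesianProduct (allFin (r + z)) (allFin (r + z)))

  ∈-allWords : ∀ w → w ∈ allWords
  ∈-allWords (inj₁ i)       = inj₁∈words _ (∈-allFin i)
  ∈-allWords (inj₂ (i , j)) = inj₂∈words _ (∈-cartesianProduct⁺ (∈-allFin i) (∈-allFin j))

  length-allWords : length allWords ≡ (r + z) + (r + z) * (r + z)
  length-allWords = begin
    length allWords
      ≡⟨ length-words (allFin (r + z)) _ ⟩
    length (allFin (r + z)) + length (cartesianProduct (allFin (r + z)) (allFin (r + z)))
      ≡⟨ ≡.cong (length (allFin (r + z)) +_) (length-cartesianProduct (allFin (r + z)) (allFin (r + z))) ⟩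
    length (allFin (r + z)) + length (allFin (r + z)) * length (allFin (r + z))
      ≡⟨ ≡.cong (λ k → k + k * k) (length-allFin (r + z)) ⟩
    (r + z) + (r + z) * (r + z)
      ∎
    where open ≡.≡-Reasoning

  word-reaches : ∀ {g} → ¬ g ≈ ε → ∃ λ w → eval w ≈ g
  word-reaches {g} g≉ε with proj₁ (proj₁ moore) ε g
  ... | inj₁ (inj₁ ε≈g) = ⊥-elim (g≉ε (sym ε≈g))
  ... | inj₁ (inj₂ (s , s∈S , g≈εs)) with ∈S⇒gen s∈S
  ...   | i , s≈gᵢ = inj₁ i , sym (trans g≈εs (trans (identityˡ s) s≈gᵢ))
  word-reaches {g} g≉ε | inj₂ (m , (s , s∈S , m≈εs) , (t , t∈S , g≈mt))
    with ∈S⇒gen s∈S | ∈S⇒gen t∈S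
  ... | i , s≈gᵢ | j , t≈gⱼ =
    inj₂ (i , j) , sym (trans g≈mt (∙-cong (trans m≈εs (trans (identityˡ s) s≈gᵢ)) t≈gⱼ))

  inverse-pair : Fin r → Word
  inverse-pair i = inj₂ (i ↑ˡ z , proj₁ (s₁-symm i) ↑ˡ z)

  inverse-pair-cancels : ∀ i → eval (inverse-pair i) ≈ ε
  inverse-pair-cancels i = begin
    gen (i ↑ˡ z) ∙ gen (j ↑ˡ z)  ≡⟨ ≡.cong₂ _∙_ (gen-↑ˡ i) (gen-↑ˡ j) ⟩
    s₁ i ∙ s₁ j                  ≈⟨ ∙-congˡ s₁ᵢ⁻¹≈s₁ⱼ ⟨
    s₁ i ∙ s₁ i ⁻¹               ≈⟨ inverseʳ (s₁ i) ⟩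
    ε                            ∎
    where
      open import Relation.Binary.Reasoning.Setoid setoid
      j : Fin r
      j = proj₁ (s₁-symm i)
      s₁ᵢ⁻¹≈s₁ⱼ : s₁ i ⁻¹ ≈ s₁ j
      s₁ᵢ⁻¹≈s₁ⱼ = proj₂ (s₁-symm i)

  inverse-pair-injective : ∀ {i j} → inverse-pair i ≡ inverse-pair j → i ≡ j
  inverse-pair-injective {i} {j} e = ↑ˡ-injective z i j (≡.cong proj₁ (Sum.inj₂-injective e))

  inverse-pairs : List Word
  inverse-pairs = map inverse-pair (allFin r)

  inverse-pairs! : Unique inverse-pairs
  inverse-pairs! = Unique.map⁺ inverse-pair-injective (Unique.allFin⁺ r)

  length-inverse-pairs : length inverse-pairs ≡ r
  length-inverse-pairs = ≡.trans (length-map inverse-pair (allFin r)) (length-allFin r)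

  ∈-inverse-pairs⇒≈ε : ∀ {w} → w ∈ inverse-pairs → eval w ≈ ε
  ∈-inverse-pairs⇒≈ε w∈ with ∈-map⁻ inverse-pair w∈
  ... | i , _ , ≡.refl = inverse-pair-cancels i

  -- Otherwise, among the (r + z) + (r + z)² words, one of p and q and the r words s s⁻¹ (s ∈ S₁)
  -- are wasted, leaving fewer than n - 1 words for the n - 1 non-identity elements.
  eval-injective-off-ε : ∀ {p q} → eval p ≈ eval q → ¬ eval p ≈ ε → p ≡ q
  eval-injective-off-ε {p} {q} p≈q p≉ε with p ≟ʷ q
  ... | yes p≡q = p≡q
  ... | no  p≢q = ⊥-elim (1+n≰n (begin
    suc (1 + ((r + z) + (r + z) * (r + z)))        ≡⟨ order+suc-r ⟨
    (z + r) ^ 2 + z + 1 + suc r                    ≡⟨ ≡.cong (_+ suc r) (proj₂ moore) ⟨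
    n + suc r                                      ≡⟨ ≡.cong (_+ suc r) (count+count-∁ (_≈? ε)) ⟨
    count (_≈? ε) + count (∁? (_≈? ε)) + suc r     ≤⟨ +-monoˡ-≤ (suc r) (+-mono-≤ ε-count ≉ε-count) ⟩
    1 + length (filter useful? allWords) + suc r   ≡⟨ +-assoc 1 _ (suc r) ⟩
    1 + (length (filter useful? allWords) + suc r) ≤⟨ +-monoʳ-≤ 1 useful-count ⟩
    1 + ((r + z) + (r + z) * (r + z))              ∎))
    where
      open ≤-Reasoning

      order+suc-r : (z + r) ^ 2 + z + 1 + suc r ≡ suc (1 + ((r + z) + (r + z) * (r + z)))
      order+suc-r = solve 2 (λ r z → (z :+ r) :^ 2 :+ z :+ con 1 :+ (con 1 :+ r)
                                 := con 1 :+ (con 1 :+ ((r :+ z) :+ (r :+ z) :* (r :+ z)))) ≡.refl r z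
        where open +-*-Solver

      Useful : Pred Word ℓ
      Useful w = ¬ eval w ≈ ε × w ≢ p

      useful? : Decidable Useful
      useful? w = ¬? (eval w ≈? ε) ×-dec ¬? (w ≟ʷ p)

      ε-count : count (_≈? ε) ≤ 1
      ε-count = cover⇒count≤length (_≈? ε) (λ g → g) (ε ∷ []) (λ g≈ε → ε , here ≡.refl , sym g≈ε)

      ≉ε-count : count (∁? (_≈? ε)) ≤ length (filter useful? allWords)
      ≉ε-count = cover⇒count≤length (∁? (_≈? ε)) eval (filter useful? allWords) covers
        where
          useful : ∀ {w g} → eval w ≈ g → ¬ g ≈ ε → w ≢ p → w ∈ filter useful? allWords
          useful w≈g g≉ε w≢p =
            ∈-filter⁺ useful? (∈-allWords _) ((λ w≈ε → g≉ε (trans (sym w≈g) w≈ε)) , w≢p)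
          covers : ∀ {g} → ¬ g ≈ ε → ∃ λ w → w ∈ filter useful? allWords × eval w ≈ g
          covers g≉ε with word-reaches g≉ε
          ... | w , w≈g with w ≟ʷ p
          ...   | yes ≡.refl = q , useful (trans (sym p≈q) w≈g) g≉ε (p≢q ∘ ≡.sym) , trans (sym p≈q) w≈g
          ...   | no  w≢p    = w , useful w≈g g≉ε w≢p , w≈g

      wasted : List Word
      wasted = p ∷ inverse-pairs

      wasted! : Unique wasted
      wasted! = All.tabulate (λ w∈ p≡w → p≉ε (trans (reflexive (≡.cong eval p≡w)) (∈-inverse-pairs⇒≈ε w∈)))
              ∷ inverse-pairs!

      wasted-useless : All (∁ Useful) wasted
      wasted-useless = (λ (_ , p≢p) → p≢p ≡.refl)
                     ∷ All.tabulate (λ w∈ (w≉ε , _) → w≉ε (∈-inverse-pairs⇒≈ε w∈))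

      useful-count : length (filter useful? allWords) + suc r ≤ (r + z) + (r + z) * (r + z)
      useful-count = begin
        length (filter useful? allWords) + suc r
          ≡⟨ ≡.cong (λ k → length (filter useful? allWords) + suc k) length-inverse-pairs ⟨
        length (filter useful? allWords) + length wasted
          ≤⟨ Unique∧⊆∧∁⇒length≤ _≟ʷ_ useful? wasted! (λ {w} _ → ∈-allWords w) wasted-useless ⟩
        length allWords
          ≡⟨ length-allWords ⟩
        (r + z) + (r + z) * (r + z)
          ∎

  commuting-generators-cancel : ∀ {i j} → i ≢ j → gen i ∙ gen j ≈ gen j ∙ gen i → gen i ∙ gen j ≈ ε
  commuting-generators-cancel {i} {j} i≢j gᵢgⱼ≈gⱼgᵢ with (gen i ∙ gen j) ≈? ε
  ... | yes gᵢgⱼ≈ε = gᵢgⱼ≈ε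
  ... | no  gᵢgⱼ≉ε =
    ⊥-elim (i≢j (≡.cong proj₁ (Sum.inj₂-injective (eval-injective-off-ε gᵢgⱼ≈gⱼgᵢ gᵢgⱼ≉ε))))

  commuting-partner-unique : ∀ {i j k} → i ≢ j → i ≢ k →
                             gen i ∙ gen j ≈ gen j ∙ gen i → gen i ∙ gen k ≈ gen k ∙ gen i → j ≡ k
  commuting-partner-unique {i} {j} {k} i≢j i≢k gᵢgⱼ≈gⱼgᵢ gᵢgₖ≈gₖgᵢ =
    gen-injective (∙-cancelˡ (gen i) (gen j) (gen k)
      (trans (commuting-generators-cancel i≢j gᵢgⱼ≈gⱼgᵢ)
             (sym (commuting-generators-cancel i≢k gᵢgₖ≈gₖgᵢ))))

mooreBound? : ∀ r z → Dec (MooreBound r z)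
mooreBound? r z = (3 ≤? 4 * r) ×-dec (9 <? 2 * (z + r)) ×-dec (4 * r ∸ 3 <? (2 * (z + r) ∸ 9) ^ 2)

-- With a ≤ 2 the inequality forces z + r < 10, and the remaining cases are checked by evaluation.
excluded-by-moore-bound : ∀ a b r z → a ≤ 2 → a + b ≡ z + r →
                          (z + r) ^ 2 + z + 1 ≤ 2 * (b + (a * b + b * a)) → ¬ MooreBound r z
excluded-by-moore-bound a b r z a≤2 a+b≡z+r order≤ =
  small-cases (s≤s a≤2) (≤-<-trans b≤z+r z+r<10) (≤-<-trans (m≤n+m r z) z+r<10)
              (≤-<-trans (m≤m+n z r) z+r<10) a+b≡z+r order≤
  where
    small-cases : ∀ {a} → a < 3 → ∀ {b} → b < 10 → ∀ {r} → r < 10 → ∀ {z} → z < 10 →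
                  a + b ≡ z + r →
                  (z + r) ^ 2 + z + 1 ≤ 2 * (b + (a * b + b * a)) → ¬ MooreBound r z
    small-cases = from-yes (allUpTo? (λ a → allUpTo? (λ b → allUpTo? (λ r → allUpTo? (λ z →
      (a + b ≟ z + r) →-dec
      ((z + r) ^ 2 + z + 1 ≤? 2 * (b + (a * b + b * a))) →-dec
      ¬? (mooreBound? r z))
      10) 10) 10) 3)

    b≤z+r : b ≤ z + r
    b≤z+r = ≤-trans (m≤n+m b a) (≤-reflexive a+b≡z+r)

    z+r<10 : z + r < 10
    z+r<10 = *-cancelʳ-< (z + r) (z + r) 10 (begin-strict
      (z + r) * (z + r)            ≡⟨ ≡.cong ((z + r) *_) (*-identityʳ (z + r)) ⟨
      (z + r) ^ 2                  ≤⟨ m≤m+n _ z ⟩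
      (z + r) ^ 2 + z              <⟨ m<m+n _ z<s ⟩
      (z + r) ^ 2 + z + 1          ≤⟨ order≤ ⟩
      2 * (b + (a * b + b * a))    ≤⟨ *-monoʳ-≤ 2 (+-monoʳ-≤ b (+-mono-≤ (*-monoˡ-≤ b a≤2) (*-monoʳ-≤ b a≤2))) ⟩
      2 * (b + (2 * b + b * 2))    ≡⟨ solve 1 (λ b → con 2 :* (b :+ (con 2 :* b :+ b :* con 2)) := con 10 :* b)
                                          ≡.refl b ⟩
      10 * b                       ≤⟨ *-monoʳ-≤ 10 b≤z+r ⟩
      10 * (z + r)                 ∎)
      where
        open ≤-Reasoning
        open +-*-Solver

module AbelianIndexTwoSubgroupOfMooreCayleyGraph
  {c ℓ} (G : Group c ℓ) {n r z : ℕ} (enumeration : FiniteOfOrder G n)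
  {s₁ : Fin r → Group.Carrier G} {s₂ : Fin z → Group.Carrier G}
  (S : MixedConnectionSet G r z s₁ s₂) (moore : MixedMooreCayley G n r z s₁ s₂)
  (H : AbelianSubgroupOfIndex2 G n) where

  open Group G
  open AbelianSubgroupOfIndex2 H using (m; has-ε; index2)
  open FiniteSetoid enumeration
  open IndexTwoSubgroup G enumeration H
  open MixedMooreCayleyGraph G enumeration S moore

  inside outside : List Generator
  inside  = filter (_∈H? ∘ gen) (allFin (r + z))
  outside = filter (∁? (_∈H? ∘ gen)) (allFin (r + z))

  a b : ℕ
  a = length inside
  b = length outside

  a+b≡z+r : a + b ≡ z + r
  a+b≡z+r = ≡.trans (length-filter+length-filter-∁ (_∈H? ∘ gen) (allFin (r + z)))
                    (≡.trans (length-allFin (r + z)) (+-comm r z))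

  a≤2 : a ≤ 2
  a≤2 = at-most-two inside (Unique.filter⁺ (_∈H? ∘ gen) (Unique.allFin⁺ (r + z)))
                           (all-filter (_∈H? ∘ gen) (allFin (r + z)))
    where
      at-most-two : ∀ gs → Unique gs → All (_∈H ∘ gen) gs → length gs ≤ 2
      at-most-two []              _ _ = z≤n
      at-most-two (_ ∷ [])        _ _ = s≤s z≤n
      at-most-two (_ ∷ _ ∷ [])    _ _ = s≤s (s≤s z≤n)
      at-most-two (_ ∷ _ ∷ _ ∷ _) ((i≢j ∷ i≢k ∷ _) ∷ (j≢k ∷ _) ∷ _) (i∈H ∷ j∈H ∷ k∈H ∷ _) =
        ⊥-elim (j≢k (commuting-partner-unique i≢j i≢k (∈H-comm i∈H j∈H) (∈H-comm i∈H k∈H)))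

  -- Products of two generators outside H lie in H, so only these words can have a value outside H.
  wordsOutside : List Word
  wordsOutside = words outside (cartesianProduct inside outside ++ cartesianProduct outside inside)

  m≤length-wordsOutside : m ≤ length wordsOutside
  m≤length-wordsOutside =
    ≤-trans (≤-reflexive (≡.sym count-∉H)) (cover⇒count≤length (∁? _∈H?) eval wordsOutside covers)
    where
      covers : ∀ {g} → ¬ g ∈H → ∃ λ w → w ∈ wordsOutside × eval w ≈ g
      covers {g} g∉H with word-reaches {g} (λ g≈ε → g∉H (∈H-resp (sym g≈ε) has-ε))
      ... | w , w≈g = w , reaching w (g∉H ∘ ∈H-resp w≈g) , w≈g
        where
          inside⁺ : ∀ {i} → gen i ∈H → i ∈ inside
          inside⁺ = ∈-filter⁺ (_∈H? ∘ gen) (∈-allFin _)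
          outside⁺ : ∀ {i} → ¬ gen i ∈H → i ∈ outside
          outside⁺ = ∈-filter⁺ (∁? (_∈H? ∘ gen)) (∈-allFin _)
          reaching : ∀ w → ¬ eval w ∈H → w ∈ wordsOutside
          reaching (inj₁ i) gᵢ∉H = inj₁∈words _ (outside⁺ gᵢ∉H)
          reaching (inj₂ (i , j)) gᵢgⱼ∉H with gen i ∈H? | gen j ∈H?
          ... | yes gᵢ∈H | yes gⱼ∈H = ⊥-elim (gᵢgⱼ∉H (∙-∈H gᵢ∈H gⱼ∈H))
          ... | yes gᵢ∈H | no  gⱼ∉H = inj₂∈words outside
                                         (∈-++⁺ˡ (∈-cartesianProduct⁺ (inside⁺ gᵢ∈H) (outside⁺ gⱼ∉H)))
          ... | no  gᵢ∉H | yes gⱼ∈H = inj₂∈words outside (∈-++⁺ʳ (cartesianProduct inside outside)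
                                         (∈-cartesianProduct⁺ (outside⁺ gᵢ∉H) (inside⁺ gⱼ∈H)))
          ... | no  gᵢ∉H | no  gⱼ∉H = ⊥-elim (gᵢgⱼ∉H (∉H∙∉H⇒∈H gᵢ∉H gⱼ∉H))

  length-wordsOutside : length wordsOutside ≡ b + (a * b + b * a)
  length-wordsOutside = begin
    length wordsOutside
      ≡⟨ length-words outside _ ⟩
    b + length (cartesianProduct inside outside ++ cartesianProduct outside inside)
      ≡⟨ ≡.cong (b +_) (length-++ (cartesianProduct inside outside)) ⟩
    b + (length (cartesianProduct inside outside) + length (cartesianProduct outside inside))
      ≡⟨ ≡.cong (b +_) (≡.cong₂ _+_ (length-cartesianProduct inside outside)
                                    (length-cartesianProduct outside inside)) ⟩
    b + (a * b + b * a)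
      ∎
    where open ≡.≡-Reasoning

  moore-order≤ : (z + r) ^ 2 + z + 1 ≤ 2 * (b + (a * b + b * a))
  moore-order≤ = begin
    (z + r) ^ 2 + z + 1          ≡⟨ proj₂ moore ⟨
    n                            ≡⟨ index2 ⟨
    2 * m                        ≤⟨ *-monoʳ-≤ 2 m≤length-wordsOutside ⟩
    2 * length wordsOutside      ≡⟨ ≡.cong (2 *_) length-wordsOutside ⟩
    2 * (b + (a * b + b * a))    ∎
    where open ≤-Reasoning

corollary1 : ∀ {c ℓ} (G : Group c ℓ) (n r z : ℕ)
    → FiniteOfOrder G n
    → (s₁ : Fin r → Group.Carrier G) (s₂ : Fin z → Group.Carrier G)
    → MixedConnectionSet G r z s₁ s₂
    → MixedMooreCayley G n r z s₁ s₂
    → MooreBound r z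
    → ¬ AbelianSubgroupOfIndex2 G n
corollary1 G n r z enumeration s₁ s₂ S moore bound H =
  excluded-by-moore-bound a b r z a≤2 a+b≡z+r moore-order≤ bound
  where open AbelianIndexTwoSubgroupOfMooreCayleyGraph G enumeration S moore H
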